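{- Let $$F(\mu_1,\mu_2,\mu_3,\nu,\omega)=1+\sum_{\mathcal{M}\in\mathbb{M}}\mu_1^{\#_{\mathcal{M}}(\nearrow)}\mu_2^{\#_{\mathcal{M}}(\searrow)}\mu_3^{\#_{\mathcal{M}}(\rightarrow)}\nu^{\#^{x}_{\mathcal{M}}(\searrow)}\omega^{\#^{x}_{\mathcal{M}}(\rightarrow)}.$$ Then $$F(\mu_1,\mu_2,\mu_3,\nu,\omega)=\frac{2}{2(1-\mu_3\omega)-\nu\bigl(1-\mu_3-\sqrt{(1-\mu_3)^2-4\mu_1\mu_2}\bigr)}.$$
   Context: A Motzkin path of length $n\ge1$ is a lattice path from $(0,0)$ to $(n,0)$ using steps $(1,1)$ (up, $\nearrow$), $(1,-1)$ (down, $\searrow$) and $(1,0)$ (level, $\rightarrow$), never going below the $x$-axis; $\mathbb{M}$ is the set of all Motzkin paths of length at least $1$. For $\mathcal{M}\in\mathbb{M}$, $\#_{\mathcal{M}}(\nearrow)$, $\#_{\mathcal{M}}(\searrow)$, $\#_{\mathcal{M}}(\rightarrow)$ are the numbers of up, down and level steps, and $\#^{x}_{\mathcal{M}}(\searrow)$, $\#^{x}_{\mathcal{M}}(\rightarrow)$ are the numbers of down steps and of level steps that end on the $x$-axis. The identity is one of formal power series, with the square root the branch equal to $1-\mu_3-\ldots$ as a power series (i.e. $\sqrt{(1-\mu_3)^2-4\mu_1\mu_2}$ has constant term $1$). -}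

module Defs where

open import Data.Nat as ℕ using (ℕ; zero; suc; _≡ᵇ_)
open import Data.Integer as ℤ using (ℤ; +_; _+_; _-_; _*_)
open import Data.Bool using (Bool; true; false; _∧_; if_then_else_)
open import Data.List using (List; []; _∷_; [_]; map; concatMap; filterᵇ; length)
open import Data.Maybe using (Maybe; just; nothing)
open import Data.Product using (_×_)
open import Relation.Binary.PropositionalEquality using (_≡_)

-- Motzkin paths as words in the steps U (↗), D (↘), L (→).

data Step : Set where
  U D L : Step

words : ℕ → List (List Step)
words zero    = [ [] ]
words (suc n) = concatMap (λ s → map (s ∷_) (words n)) (U ∷ D ∷ L ∷ [])

walk : ℕ → List Step → Maybe ℕ
walk h       []      = just h
walk h       (U ∷ w) = walk (suc h) w
walk zero    (D ∷ w) = nothing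
walk (suc h) (D ∷ w) = walk h w
walk h       (L ∷ w) = walk h w

isMotzkin : List Step → Bool
isMotzkin w with walk 0 w
... | just zero = true
... | _         = false

motzkin : ℕ → List (List Step)
motzkin n = filterᵇ isMotzkin (words n)

#U #D #L : List Step → ℕ
#U [] = 0
#U (U ∷ w) = suc (#U w)
#U (_ ∷ w) = #U w
#D [] = 0
#D (D ∷ w) = suc (#D w)
#D (_ ∷ w) = #D w
#L [] = 0
#L (L ∷ w) = suc (#L w)
#L (_ ∷ w) = #L w

-- down steps ending on the x-axis, for a walk started at height h
#Dx : ℕ → List Step → ℕ
#Dx h []             = 0
#Dx h (U ∷ w)        = #Dx (suc h) w
#Dx zero (D ∷ w)     = #Dx zero w   -- unreachable for Motzkin paths
#Dx (suc zero) (D ∷ w) = suc (#Dx zero w)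
#Dx (suc (suc h)) (D ∷ w) = #Dx (suc h) w
#Dx h (L ∷ w)        = #Dx h w

-- level steps ending on the x-axis, for a walk started at height h
#Lx : ℕ → List Step → ℕ
#Lx h []          = 0
#Lx h (U ∷ w)     = #Lx (suc h) w
#Lx zero (D ∷ w)  = #Lx zero w      -- unreachable for Motzkin paths
#Lx (suc h) (D ∷ w) = #Lx h w
#Lx zero (L ∷ w)  = suc (#Lx zero w)
#Lx (suc h) (L ∷ w) = #Lx (suc h) w

-- Formal power series in five variables μ₁ μ₂ μ₃ ν ω over ℤ,
-- represented by their coefficient functions (exponents in this order).

FPS : Set
FPS = ℕ → ℕ → ℕ → ℕ → ℕ → ℤ

_≈ₛ_ : FPS → FPS → Set
f ≈ₛ g = ∀ a b c d e → f a b c d e ≡ g a b c d e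
infix 4 _≈ₛ_

sumTo : ℕ → (ℕ → ℤ) → ℤ
sumTo zero    f = f 0
sumTo (suc n) f = sumTo n f + f (suc n)

_+ₛ_ _-ₛ_ _*ₛ_ : FPS → FPS → FPS
(f +ₛ g) a b c d e = f a b c d e + g a b c d e
(f -ₛ g) a b c d e = f a b c d e - g a b c d e
(f *ₛ g) a b c d e =
  sumTo a λ i → sumTo b λ j → sumTo c λ k → sumTo d λ l → sumTo e λ m →
    f i j k l m * g (a ℕ.∸ i) (b ℕ.∸ j) (c ℕ.∸ k) (d ℕ.∸ l) (e ℕ.∸ m)
infixl 6 _+ₛ_ _-ₛ_
infixl 7 _*ₛ_

mono : ℤ → ℕ → ℕ → ℕ → ℕ → ℕ → FPS
mono z i j k l m a b c d e =
  if (a ≡ᵇ i) ∧ (b ≡ᵇ j) ∧ (c ≡ᵇ k) ∧ (d ≡ᵇ l) ∧ (e ≡ᵇ m) then z else + 0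

const : ℤ → FPS
const z = mono z 0 0 0 0 0

μ₁ μ₂ μ₃ ν ω : FPS
μ₁ = mono (+ 1) 1 0 0 0 0
μ₂ = mono (+ 1) 0 1 0 0 0
μ₃ = mono (+ 1) 0 0 1 0 0
ν  = mono (+ 1) 0 0 0 1 0
ω  = mono (+ 1) 0 0 0 0 1

-- Coefficient of μ₁^a μ₂^b μ₃^c ν^d ω^e: the number of Motzkin paths of
-- length ≥ 1 with a up, b down, c level steps, d down steps ending on the
-- x-axis and e level steps ending on the x-axis (any such path has length
-- a+b+c), plus 1 for the constant term.

matches : ℕ → ℕ → ℕ → ℕ → ℕ → List Step → Bool
matches a b c d e w =
  (#U w ≡ᵇ a) ∧ (#D w ≡ᵇ b) ∧ (#L w ≡ᵇ c) ∧ (#Dx 0 w ≡ᵇ d) ∧ (#Lx 0 w ≡ᵇ e)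

pathCount : ℕ → ℕ → ℕ → ℕ → ℕ → ℕ
pathCount a b c d e with a ℕ.+ b ℕ.+ c
... | zero  = 0            -- only length ≥ 1 paths are in 𝕄
... | suc n = length (filterᵇ (matches a b c d e) (motzkin (suc n)))

F : FPS
F a b c d e = const (+ 1) a b c d e + + pathCount a b c d e

radicand : FPS
radicand = (const (+ 1) -ₛ μ₃) *ₛ (const (+ 1) -ₛ μ₃) -ₛ const (+ 4) *ₛ μ₁ *ₛ μ₂

IsSqrtRadicand : FPS → Set
IsSqrtRadicand S = (S *ₛ S ≈ₛ radicand) × (S 0 0 0 0 0 ≡ + 1)

denom : FPS → FPS
denom S = const (+ 2) *ₛ (const (+ 1) -ₛ μ₃ *ₛ ω)
          -ₛ ν *ₛ (const (+ 1) -ₛ μ₃ -ₛ S)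

-- Let W h be the generating function of the walks from height h that end on the axis, so that
-- F = W 0. Splitting off the first step gives W 0 = 1 + μ₁ W 1 + μ₃ ω W 0 and
-- W (h+1) = μ₁ W (h+2) + μ₂ ν^[h=0] W h + μ₃ W (h+1). Since μ₁, μ₂, μ₃ raise the total degree, these
-- equations determine W (h+1) from W 0, and they are also solved by ν P^(h+1) W 0, where the
-- first-passage series P is the fixed point of P = μ₂ + μ₃ P + μ₁ P². Hence F = 1 + μ₁ ν P F + μ₃ ω F.
-- The series S₀ = 1 - μ₃ - 2 μ₁ P squares to (1 - μ₃)² - 4 μ₁ μ₂ by the equation for P, and it is the
-- only square root with constant term 1 because 2 is not a zero divisor. Substituting,
-- F · (2 (1 - μ₃ ω) - ν (1 - μ₃ - S₀)) = 2 (F - μ₁ ν P F - μ₃ ω F) = 2.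

module Submission where

open import Level using (0ℓ)
open import Algebra.Bundles using (CommutativeRing)
open import Algebra.Structures using (IsCommutativeRing)
import Algebra.Construct.Pointwise as Pointwise
open import Data.Nat as ℕ using (ℕ; zero; suc; _∸_; _≤_; z≤n; s≤s; _≡ᵇ_)
import Data.Nat.Properties as ℕₚ
open import Data.Integer as ℤ using (ℤ; +_; -[1+_])
import Data.Integer.Properties as ℤₚ
open import Data.Product using (_×_; ∃; _,_)
open import Data.Sum using (inj₁; inj₂)
open import Data.Unit using (⊤; tt)
open import Data.Maybe using (Maybe; just; nothing)
open import Data.Bool using (Bool; true; false; _∧_; if_then_else_)
import Data.Bool.Properties as Boolₚ
open import Data.List using (List; []; _∷_; map; _++_; filterᵇ; length)
open import Relation.Nullary using (yes; no)
open import Algebra.Solver.Ring.AlmostCommutativeRing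
  using (AlmostCommutativeRing; fromCommutativeRing; _-Raw-AlmostCommutative⟶_)
open import Relation.Binary.PropositionalEquality as ≡ using (_≡_)
import Relation.Binary.Reasoning.Setoid as SetoidReasoning
open import Defs

-- Power series over a commutative ring

IsRegular : (R : CommutativeRing 0ℓ 0ℓ) → CommutativeRing.Carrier R → Set
IsRegular R x = ∀ y → y * x ≈ 0# → y ≈ 0#
  where open CommutativeRing R

module PowerSeries (R : CommutativeRing 0ℓ 0ℓ) where

  open CommutativeRing R hiding (isCommutativeRing; zero)
  open SetoidReasoning setoid

  Σ : ℕ → (ℕ → Carrier) → Carrier
  Σ zero    f = f 0
  Σ (suc n) f = Σ n f + f (suc n)

  Σ-cong : ∀ n {f g : ℕ → Carrier} → (∀ i → i ≤ n → f i ≈ g i) → Σ n f ≈ Σ n g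
  Σ-cong zero    f≈g = f≈g 0 z≤n
  Σ-cong (suc n) f≈g =
    +-cong (Σ-cong n (λ i i≤n → f≈g i (ℕₚ.m≤n⇒m≤1+n i≤n))) (f≈g (suc n) ℕₚ.≤-refl)

  Σ-zero : ∀ n {f : ℕ → Carrier} → (∀ i → i ≤ n → f i ≈ 0#) → Σ n f ≈ 0#
  Σ-zero zero    f≈0 = f≈0 0 z≤n
  Σ-zero (suc n) f≈0 = begin
    Σ n _ + _  ≈⟨ +-cong (Σ-zero n (λ i i≤n → f≈0 i (ℕₚ.m≤n⇒m≤1+n i≤n))) (f≈0 (suc n) ℕₚ.≤-refl) ⟩
    0# + 0#    ≈⟨ +-identityˡ 0# ⟩
    0#         ∎

  Σ-+ : ∀ n (f g : ℕ → Carrier) → Σ n (λ i → f i + g i) ≈ Σ n f + Σ n g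
  Σ-+ zero    f g = refl
  Σ-+ (suc n) f g = begin
    Σ n (λ i → f i + g i) + (f (suc n) + g (suc n))  ≈⟨ +-congʳ (Σ-+ n f g) ⟩
    (Σ n f + Σ n g) + (f (suc n) + g (suc n))        ≈⟨ +-assoc _ _ _ ⟩
    Σ n f + (Σ n g + (f (suc n) + g (suc n)))        ≈⟨ +-congˡ (sym (+-assoc _ _ _)) ⟩
    Σ n f + ((Σ n g + f (suc n)) + g (suc n))        ≈⟨ +-congˡ (+-congʳ (+-comm _ _)) ⟩
    Σ n f + ((f (suc n) + Σ n g) + g (suc n))        ≈⟨ +-congˡ (+-assoc _ _ _) ⟩
    Σ n f + (f (suc n) + (Σ n g + g (suc n)))        ≈⟨ sym (+-assoc _ _ _) ⟩
    (Σ n f + f (suc n)) + (Σ n g + g (suc n))        ∎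

  Σ-*ˡ : ∀ n x (f : ℕ → Carrier) → x * Σ n f ≈ Σ n (λ i → x * f i)
  Σ-*ˡ zero    x f = refl
  Σ-*ˡ (suc n) x f = trans (distribˡ x _ _) (+-congʳ (Σ-*ˡ n x f))

  Σ-*ʳ : ∀ n x (f : ℕ → Carrier) → Σ n f * x ≈ Σ n (λ i → f i * x)
  Σ-*ʳ zero    x f = refl
  Σ-*ʳ (suc n) x f = trans (distribʳ x _ _) (+-congʳ (Σ-*ʳ n x f))

  Σ-suc : ∀ n (f : ℕ → Carrier) → Σ (suc n) f ≈ f 0 + Σ n (λ i → f (suc i))
  Σ-suc zero    f = refl
  Σ-suc (suc n) f = trans (+-congʳ (Σ-suc n f)) (+-assoc _ _ _)

  Σ-head : ∀ n (f : ℕ → Carrier) → (∀ i → f (suc i) ≈ 0#) → Σ n f ≈ f 0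
  Σ-head zero    f tail≈0 = refl
  Σ-head (suc n) f tail≈0 = trans (+-cong (Σ-head n f tail≈0) (tail≈0 n)) (+-identityʳ _)

  Σ-reverse : ∀ n (f : ℕ → Carrier) → Σ n f ≈ Σ n (λ i → f (n ∸ i))
  Σ-reverse zero    f = refl
  Σ-reverse (suc n) f = begin
    Σ n f + f (suc n)                   ≈⟨ +-congʳ (Σ-reverse n f) ⟩
    Σ n (λ i → f (n ∸ i)) + f (suc n)   ≈⟨ +-comm _ _ ⟩
    f (suc n) + Σ n (λ i → f (n ∸ i))   ≈⟨ Σ-suc n (λ i → f (suc n ∸ i)) ⟨
    Σ (suc n) (λ i → f (suc n ∸ i))     ∎

  Σ-triangle : ∀ n (C : ℕ → ℕ → Carrier) →
    Σ n (λ i → Σ i (λ j → C j i)) ≈ Σ n (λ j → Σ (n ∸ j) (λ k → C j (j ℕ.+ k)))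
  Σ-triangle zero    C = refl
  Σ-triangle (suc n) C = begin
    Σ (suc n) (λ i → Σ i (λ j → C j i))
      ≈⟨ Σ-suc n _ ⟩
    C 0 0 + Σ n (λ i → Σ (suc i) (λ j → C j (suc i)))
      ≈⟨ +-congˡ (Σ-cong n (λ i _ → Σ-suc i (λ j → C j (suc i)))) ⟩
    C 0 0 + Σ n (λ i → C 0 (suc i) + Σ i (λ j → C (suc j) (suc i)))
      ≈⟨ +-congˡ (Σ-+ n _ _) ⟩
    C 0 0 + (Σ n (λ i → C 0 (suc i)) + Σ n (λ i → Σ i (λ j → C (suc j) (suc i))))
      ≈⟨ +-assoc _ _ _ ⟨
    (C 0 0 + Σ n (λ i → C 0 (suc i))) + Σ n (λ i → Σ i (λ j → C (suc j) (suc i)))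
      ≈⟨ +-cong (sym (Σ-suc n (C 0))) (Σ-triangle n (λ j i → C (suc j) (suc i))) ⟩
    Σ (suc n) (C 0) + Σ n (λ j → Σ (n ∸ j) (λ k → C (suc j) (suc (j ℕ.+ k))))
      ≈⟨ Σ-suc n (λ j → Σ (suc n ∸ j) (λ k → C j (j ℕ.+ k))) ⟨
    Σ (suc n) (λ j → Σ (suc n ∸ j) (λ k → C j (j ℕ.+ k)))
      ∎

  Series : Set
  Series = ℕ → Carrier

  ι : Carrier → Series
  ι x zero    = x
  ι x (suc _) = 0#

  _≈ₚ_ : Series → Series → Set
  f ≈ₚ g = ∀ n → f n ≈ g n

  _+ₚ_ _*ₚ_ : Series → Series → Series
  (f +ₚ g) n = f n + g n
  (f *ₚ g) n = Σ n (λ i → f i * g (n ∸ i))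

  infix  4 _≈ₚ_
  infixl 6 _+ₚ_
  infixl 7 _*ₚ_

  -ₚ_ : Series → Series
  (-ₚ f) n = - f n

  0ₚ 1ₚ : Series
  0ₚ _ = 0#
  1ₚ = ι 1#

  *ₚ-cong : ∀ {f f′ g g′} → f ≈ₚ f′ → g ≈ₚ g′ → f *ₚ g ≈ₚ f′ *ₚ g′
  *ₚ-cong f≈f′ g≈g′ n = Σ-cong n (λ i _ → *-cong (f≈f′ i) (g≈g′ (n ∸ i)))

  *ₚ-comm : ∀ f g → f *ₚ g ≈ₚ g *ₚ f
  *ₚ-comm f g n = begin
    Σ n (λ i → f i * g (n ∸ i))             ≈⟨ Σ-reverse n _ ⟩
    Σ n (λ i → f (n ∸ i) * g (n ∸ (n ∸ i)))  ≈⟨ Σ-cong n (λ i i≤n →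
      trans (*-comm _ _) (*-congʳ (reflexive (≡.cong g (ℕₚ.m∸[m∸n]≡n i≤n))))) ⟩
    Σ n (λ i → g i * f (n ∸ i))             ∎

  *ₚ-identityˡ : ∀ f → 1ₚ *ₚ f ≈ₚ f
  *ₚ-identityˡ f n = trans (Σ-head n _ (λ i → zeroˡ _)) (*-identityˡ (f n))

  *ₚ-assoc : ∀ f g h → (f *ₚ g) *ₚ h ≈ₚ f *ₚ (g *ₚ h)
  *ₚ-assoc f g h n = begin
    Σ n (λ i → Σ i (λ j → f j * g (i ∸ j)) * h (n ∸ i))
      ≈⟨ Σ-cong n (λ i _ → Σ-*ʳ i _ _) ⟩
    Σ n (λ i → Σ i (λ j → f j * g (i ∸ j) * h (n ∸ i)))
      ≈⟨ Σ-triangle n (λ j i → f j * g (i ∸ j) * h (n ∸ i)) ⟩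
    Σ n (λ j → Σ (n ∸ j) (λ k → f j * g (j ℕ.+ k ∸ j) * h (n ∸ (j ℕ.+ k))))
      ≈⟨ Σ-cong n (λ j _ → Σ-cong (n ∸ j) (λ k _ → trans (*-assoc _ _ _)
           (*-congˡ (*-cong (reflexive (≡.cong g (ℕₚ.m+n∸m≡n j k)))
                            (reflexive (≡.cong h (≡.sym (ℕₚ.∸-+-assoc n j k)))))))) ⟩
    Σ n (λ j → Σ (n ∸ j) (λ k → f j * (g k * h (n ∸ j ∸ k))))
      ≈⟨ Σ-cong n (λ j _ → Σ-*ˡ (n ∸ j) _ _) ⟨
    Σ n (λ j → f j * Σ (n ∸ j) (λ k → g k * h (n ∸ j ∸ k)))
      ∎

  *ₚ-distribˡ : ∀ f g h → f *ₚ (g +ₚ h) ≈ₚ (f *ₚ g) +ₚ (f *ₚ h)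
  *ₚ-distribˡ f g h n = trans (Σ-cong n (λ i _ → distribˡ _ _ _)) (Σ-+ n _ _)

  *ₚ-distribʳ : ∀ f g h → (g +ₚ h) *ₚ f ≈ₚ (g *ₚ f) +ₚ (h *ₚ f)
  *ₚ-distribʳ f g h n = trans (Σ-cong n (λ i _ → distribʳ _ _ _)) (Σ-+ n _ _)

  isCommutativeRing : IsCommutativeRing _≈ₚ_ _+ₚ_ _*ₚ_ -ₚ_ 0ₚ 1ₚ
  isCommutativeRing = record
    { isRing = record
      { +-isAbelianGroup = Pointwise.isAbelianGroup ℕ +-isAbelianGroup
      ; *-cong           = *ₚ-cong
      ; *-assoc          = *ₚ-assoc
      ; *-identity       = *ₚ-identityˡ , λ f n → trans (*ₚ-comm f 1ₚ n) (*ₚ-identityˡ f n)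
      ; distrib          = *ₚ-distribˡ , *ₚ-distribʳ
      }
    ; *-comm = *ₚ-comm
    }

  commutativeRing : CommutativeRing 0ℓ 0ℓ
  commutativeRing = record { isCommutativeRing = isCommutativeRing }

  shift : Series → Series
  shift f zero    = 0#
  shift f (suc n) = f n

  X : Series
  X = shift 1ₚ

  shift-*ˡ : ∀ f g → shift f *ₚ g ≈ₚ shift (f *ₚ g)
  shift-*ˡ f g zero    = zeroˡ (g 0)
  shift-*ˡ f g (suc n) = begin
    Σ (suc n) (λ i → shift f i * g (suc n ∸ i))      ≈⟨ Σ-suc n _ ⟩
    0# * g (suc n) + Σ n (λ i → f i * g (n ∸ i))     ≈⟨ +-congʳ (zeroˡ _) ⟩
    0# + Σ n (λ i → f i * g (n ∸ i))                 ≈⟨ +-identityˡ _ ⟩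
    Σ n (λ i → f i * g (n ∸ i))                      ∎

  X-*ˡ : ∀ f → X *ₚ f ≈ₚ shift f
  X-*ˡ f zero    = shift-*ˡ 1ₚ f zero
  X-*ˡ f (suc n) = trans (shift-*ˡ 1ₚ f (suc n)) (*ₚ-identityˡ f n)

  ι-*ˡ : ∀ x f → ι x *ₚ f ≈ₚ (λ n → x * f n)
  ι-*ˡ x f n = Σ-head n _ (λ i → zeroˡ _)

  -- By induction on n: coefficient n of g * f is g n * f 0 plus products of earlier coefficients of g.
  regular : ∀ {f} → IsRegular R (f 0) → IsRegular commutativeRing f
  regular {f} f₀-regular g gf≈0 n = vanish n n ℕₚ.≤-refl
    where
    vanish : ∀ n i → i ≤ n → g i ≈ 0#
    vanish zero    .zero z≤n = f₀-regular (g 0) (gf≈0 0)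
    vanish (suc n) i  i≤1+n with ℕₚ.m≤n⇒m<n∨m≡n i≤1+n
    ... | inj₁ i<1+n  = vanish n i (ℕₚ.≤-pred i<1+n)
    ... | inj₂ ≡.refl = f₀-regular (g (suc n)) (begin
      g (suc n) * f 0                                              ≈⟨ +-identityˡ _ ⟨
      0# + g (suc n) * f 0                                         ≈⟨ +-congʳ (Σ-zero n (λ j j≤n →
                                                                        trans (*-congʳ (vanish n j j≤n)) (zeroˡ _))) ⟨
      Σ n (λ j → g j * f (suc n ∸ j)) + g (suc n) * f 0            ≈⟨ +-congˡ (*-congˡ (reflexive (≡.cong f (≡.sym (ℕₚ.n∸n≡0 n))))) ⟩
      (g *ₚ f) (suc n)                                             ≈⟨ gf≈0 (suc n) ⟩
      0#                                                           ∎)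

-- Complete filtrations and fixed points

record CompleteFiltration (R : CommutativeRing 0ℓ 0ℓ) : Set₁ where
  open CommutativeRing R
  infix 4 _≈[_]_
  field
    _≈[_]_     : Carrier → ℕ → Carrier → Set
    ≈[0]       : ∀ {x y} → x ≈[ 0 ] y
    ≈⇒≈[]      : ∀ {N x y} → x ≈ y → x ≈[ N ] y
    ≈[]-sym    : ∀ {N x y} → x ≈[ N ] y → y ≈[ N ] x
    ≈[]-trans  : ∀ {N x y z} → x ≈[ N ] y → y ≈[ N ] z → x ≈[ N ] z
    ≈[]-weaken : ∀ {M N x y} → M ≤ N → x ≈[ N ] y → x ≈[ M ] y
    +-cong[]   : ∀ {N x x′ y y′} → x ≈[ N ] x′ → y ≈[ N ] y′ → x + y ≈[ N ] x′ + y′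
    *-cong[]   : ∀ {N x x′ y y′} → x ≈[ N ] x′ → y ≈[ N ] y′ → x * y ≈[ N ] x′ * y′
    separated  : ∀ {x y} → (∀ N → x ≈[ N ] y) → x ≈ y
    lim        : (ℕ → Carrier) → Carrier
    lim-approx : ∀ f → (∀ k → f k ≈[ k ] f (suc k)) → ∀ k → f k ≈[ k ] lim f

  ≈[]-retag : ∀ {M N x y} → M ≡ N → x ≈[ N ] y → x ≈[ M ] y
  ≈[]-retag M≡N = ≈[]-weaken (ℕₚ.≤-reflexive M≡N)

  Raising : (Carrier → Carrier) → Set
  Raising φ = ∀ {N x y} → x ≈[ N ] y → φ x ≈[ suc N ] φ y

  Raising-resp : ∀ {φ ψ} → (∀ x → φ x ≈ ψ x) → Raising φ → Raising ψ
  Raising-resp φ≈ψ φ-raising x≈y =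
    ≈[]-trans (≈⇒≈[] (sym (φ≈ψ _))) (≈[]-trans (φ-raising x≈y) (≈⇒≈[] (φ≈ψ _)))

  module _ (Φ : Carrier → Carrier) (Φ-raising : Raising Φ) where

    private
      approx : ℕ → Carrier
      approx zero    = 0#
      approx (suc k) = Φ (approx k)

      approx-cauchy : ∀ k → approx k ≈[ k ] approx (suc k)
      approx-cauchy zero    = ≈[0]
      approx-cauchy (suc k) = Φ-raising (approx-cauchy k)

    fixpoint : Carrier
    fixpoint = lim approx

    fixpoint-unfold : fixpoint ≈ Φ fixpoint
    fixpoint-unfold = separated λ where
      zero    → ≈[0]
      (suc N) → ≈[]-trans (≈[]-sym (lim-approx approx approx-cauchy (suc N)))
                          (Φ-raising (lim-approx approx approx-cauchy N))

-- The discrete filtration: integers agree to any positive order only when they are equal.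
discreteFiltration : CompleteFiltration ℤₚ.+-*-commutativeRing
discreteFiltration = record
  { _≈[_]_     = _≡[_]_
  ; ≈[0]       = tt
  ; ≈⇒≈[]      = λ { {zero} _ → tt ; {suc _} x≡y → x≡y }
  ; ≈[]-sym    = λ { {zero} _ → tt ; {suc _} x≡y → ≡.sym x≡y }
  ; ≈[]-trans  = λ { {zero} _ _ → tt ; {suc _} x≡y y≡z → ≡.trans x≡y y≡z }
  ; ≈[]-weaken = λ { z≤n _ → tt ; (s≤s _) x≡y → x≡y }
  ; +-cong[]   = λ { {zero} _ _ → tt ; {suc _} x≡x′ y≡y′ → ≡.cong₂ ℤ._+_ x≡x′ y≡y′ }
  ; *-cong[]   = λ { {zero} _ _ → tt ; {suc _} x≡x′ y≡y′ → ≡.cong₂ ℤ._*_ x≡x′ y≡y′ }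
  ; separated  = λ x≡[]y → x≡[]y 1
  ; lim        = λ f → f 1
  ; lim-approx = λ { f cauchy zero → tt ; f cauchy (suc k) → stable f cauchy k }
  }
  where
  _≡[_]_ : ℤ → ℕ → ℤ → Set
  x ≡[ zero  ] y = ⊤
  x ≡[ suc _ ] y = x ≡ y

  stable : ∀ f → (∀ k → f k ≡[ k ] f (suc k)) → ∀ k → f (suc k) ≡ f 1
  stable f cauchy zero    = ≡.refl
  stable f cauchy (suc k) = ≡.trans (≡.sym (cauchy (suc k))) (stable f cauchy k)

-- Series agree up to order N when their coefficients of index n agree up to order N ∸ n;
-- for iterated power series this is agreement up to total degree N.
module PowerSeriesFiltration {R : CommutativeRing 0ℓ 0ℓ} (F : CompleteFiltration R) where

  open CommutativeRing R using (Carrier; refl)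
  open CompleteFiltration F
  open PowerSeries R

  Σ-cong[] : ∀ {N} n {f g : ℕ → Carrier} → (∀ i → i ≤ n → f i ≈[ N ] g i) → Σ n f ≈[ N ] Σ n g
  Σ-cong[] zero    f≈g = f≈g 0 z≤n
  Σ-cong[] (suc n) f≈g =
    +-cong[] (Σ-cong[] n (λ i i≤n → f≈g i (ℕₚ.m≤n⇒m≤1+n i≤n))) (f≈g (suc n) ℕₚ.≤-refl)

  infix 4 _≈ₚ[_]_
  _≈ₚ[_]_ : Series → ℕ → Series → Set
  f ≈ₚ[ N ] g = ∀ n → f n ≈[ N ∸ n ] g n

  *ₚ-cong[] : ∀ {N f f′ g g′} → f ≈ₚ[ N ] f′ → g ≈ₚ[ N ] g′ → f *ₚ g ≈ₚ[ N ] f′ *ₚ g′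
  *ₚ-cong[] {N} f≈f′ g≈g′ n = Σ-cong[] n λ i i≤n →
    *-cong[] (≈[]-weaken (ℕₚ.∸-monoʳ-≤ N i≤n) (f≈f′ i))
             (≈[]-weaken (ℕₚ.∸-monoʳ-≤ N (ℕₚ.m∸n≤m n i)) (g≈g′ (n ∸ i)))

  limₚ : (ℕ → Series) → Series
  limₚ f n = lim (λ k → f (k ℕ.+ n) n)

  limₚ-approx : ∀ f → (∀ k → f k ≈ₚ[ k ] f (suc k)) → ∀ k → f k ≈ₚ[ k ] limₚ f
  limₚ-approx f cauchy k n with ℕₚ.≤-total n k
  ... | inj₁ n≤k = ≡.subst (λ m → f m n ≈[ k ∸ n ] limₚ f n) (ℕₚ.m∸n+n≡m n≤k)
                     (lim-approx _ coefficient-cauchy (k ∸ n))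
    where
    coefficient-cauchy : ∀ j → f (j ℕ.+ n) n ≈[ j ] f (suc j ℕ.+ n) n
    coefficient-cauchy j = ≈[]-retag (≡.sym (ℕₚ.m+n∸n≡m j n)) (cauchy (j ℕ.+ n) n)
  ... | inj₂ k≤n = ≈[]-retag (ℕₚ.m≤n⇒m∸n≡0 k≤n) ≈[0]

  filtration : CompleteFiltration commutativeRing
  filtration = record
    { _≈[_]_     = _≈ₚ[_]_
    ; ≈[0]       = λ n → ≈[]-retag (ℕₚ.0∸n≡0 n) ≈[0]
    ; ≈⇒≈[]      = λ f≈g n → ≈⇒≈[] (f≈g n)
    ; ≈[]-sym    = λ f≈g n → ≈[]-sym (f≈g n)
    ; ≈[]-trans  = λ f≈g g≈h n → ≈[]-trans (f≈g n) (g≈h n)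
    ; ≈[]-weaken = λ M≤N f≈g n → ≈[]-weaken (ℕₚ.∸-monoˡ-≤ n M≤N) (f≈g n)
    ; +-cong[]   = λ f≈f′ g≈g′ n → +-cong[] (f≈f′ n) (g≈g′ n)
    ; *-cong[]   = *ₚ-cong[]
    ; separated  = λ f≈[]g n → separated λ M →
                     ≈[]-retag (≡.sym (ℕₚ.m+n∸n≡m M n)) (f≈[]g (M ℕ.+ n) n)
    ; lim        = limₚ
    ; lim-approx = limₚ-approx
    }

  shift-raising : CompleteFiltration.Raising filtration shift
  shift-raising f≈g zero    = ≈⇒≈[] refl
  shift-raising f≈g (suc n) = f≈g n

  map-raising : ∀ {φ} → Raising φ → CompleteFiltration.Raising filtration (λ f n → φ (f n))
  map-raising φ-raising {N} f≈g n = ≈[]-weaken (suc∸≤suc∸ N n) (φ-raising (f≈g n))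
    where
    suc∸≤suc∸ : ∀ m n → suc m ∸ n ≤ suc (m ∸ n)
    suc∸≤suc∸ m n = ℕₚ.m≤n+o⇒m∸n≤o (suc m) n
      (ℕₚ.≤-trans (s≤s (ℕₚ.m≤n+m∸n m n)) (ℕₚ.≤-reflexive (≡.sym (ℕₚ.+-suc n (m ∸ n)))))

-- Ring identities

module IntegerCoefficients (R : CommutativeRing 0ℓ 0ℓ) where

  open CommutativeRing R
  open import Algebra.Properties.Semiring.Mult.TCOptimised semiring
    using (×-homo-+; ×1-homo-*; ×-cong; 1+×) renaming (_×_ to _⊠_)
  open import Algebra.Properties.Group +-group using (ε⁻¹≈ε; ⁻¹-involutive)
  open import Algebra.Properties.Ring ring using (-‿distribˡ-*; -‿distribʳ-*)
  open import Algebra.Properties.AbelianGroup +-abelianGroup using (⁻¹-∙-comm)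
  open SetoidReasoning setoid

  ⟦_⟧ : ℤ → Carrier
  ⟦ + n      ⟧ = n ⊠ 1#
  ⟦ -[1+ n ] ⟧ = - (suc n ⊠ 1#)

  ⟦⟧-neg : ∀ i → ⟦ ℤ.- i ⟧ ≈ - ⟦ i ⟧
  ⟦⟧-neg (+ zero)  = sym ε⁻¹≈ε
  ⟦⟧-neg (+ suc n) = refl
  ⟦⟧-neg -[1+ n ]  = sym (⁻¹-involutive _)

  ⟦⟧-⊖ : ∀ m n → ⟦ m ℤ.⊖ n ⟧ ≈ m ⊠ 1# - n ⊠ 1#
  ⟦⟧-⊖ m       zero    = begin
    ⟦ m ℤ.⊖ 0 ⟧       ≈⟨ reflexive (≡.cong ⟦_⟧ (ℤₚ.⊖-≥ {m} {0} z≤n)) ⟩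
    m ⊠ 1#            ≈⟨ +-identityʳ _ ⟨
    m ⊠ 1# + 0#       ≈⟨ +-congˡ ε⁻¹≈ε ⟨
    m ⊠ 1# - 0#       ∎
  ⟦⟧-⊖ zero    (suc n) = sym (+-identityˡ _)
  ⟦⟧-⊖ (suc m) (suc n) = begin
    ⟦ suc m ℤ.⊖ suc n ⟧         ≈⟨ reflexive (≡.cong ⟦_⟧ (ℤₚ.[1+m]⊖[1+n]≡m⊖n m n)) ⟩
    ⟦ m ℤ.⊖ n ⟧                 ≈⟨ ⟦⟧-⊖ m n ⟩
    a - b                       ≈⟨ +-identityˡ _ ⟨
    0# + (a - b)                ≈⟨ +-congʳ (-‿inverseʳ 1#) ⟨
    (1# - 1#) + (a - b)         ≈⟨ +-assoc _ _ _ ⟩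
    1# + (- 1# + (a - b))       ≈⟨ +-congˡ (+-assoc _ _ _) ⟨
    1# + ((- 1# + a) - b)       ≈⟨ +-congˡ (+-congʳ (+-comm _ _)) ⟩
    1# + ((a - 1#) - b)         ≈⟨ +-congˡ (+-assoc _ _ _) ⟩
    1# + (a + (- 1# - b))       ≈⟨ +-assoc _ _ _ ⟨
    (1# + a) + (- 1# - b)       ≈⟨ +-congˡ (⁻¹-∙-comm _ _) ⟩
    (1# + a) - (1# + b)         ≈⟨ +-cong (1+× m 1#) (-‿cong (1+× n 1#)) ⟨
    suc m ⊠ 1# - suc n ⊠ 1#     ∎
    where a = m ⊠ 1#
          b = n ⊠ 1#

  ⟦⟧-+ : ∀ i j → ⟦ i ℤ.+ j ⟧ ≈ ⟦ i ⟧ + ⟦ j ⟧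
  ⟦⟧-+ (+ m)    (+ n)    = ×-homo-+ 1# m n
  ⟦⟧-+ (+ m)    -[1+ n ] = ⟦⟧-⊖ m (suc n)
  ⟦⟧-+ -[1+ m ] (+ n)    = trans (⟦⟧-⊖ n (suc m)) (+-comm _ _)
  ⟦⟧-+ -[1+ m ] -[1+ n ] = begin
    - (suc (suc (m ℕ.+ n)) ⊠ 1#)   ≈⟨ -‿cong (×-cong (≡.sym (≡.cong suc (ℕₚ.+-suc m n))) refl) ⟩
    - ((suc m ℕ.+ suc n) ⊠ 1#)     ≈⟨ -‿cong (×-homo-+ 1# (suc m) (suc n)) ⟩
    - (suc m ⊠ 1# + suc n ⊠ 1#)    ≈⟨ ⁻¹-∙-comm _ _ ⟨
    - (suc m ⊠ 1#) - suc n ⊠ 1#    ∎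

  ⟦⟧-*-+ : ∀ m j → ⟦ + m ℤ.* j ⟧ ≈ ⟦ + m ⟧ * ⟦ j ⟧
  ⟦⟧-*-+ m (+ n)    = trans (reflexive (≡.cong ⟦_⟧ (≡.sym (ℤₚ.pos-* m n)))) (×1-homo-* m n)
  ⟦⟧-*-+ m -[1+ n ] = begin
    ⟦ + m ℤ.* -[1+ n ] ⟧              ≈⟨ reflexive (≡.cong ⟦_⟧ (≡.sym (ℤₚ.neg-distribʳ-* (+ m) (+ suc n)))) ⟩
    ⟦ ℤ.- (+ m ℤ.* + suc n) ⟧         ≈⟨ ⟦⟧-neg (+ m ℤ.* + suc n) ⟩
    - ⟦ + m ℤ.* + suc n ⟧             ≈⟨ -‿cong (⟦⟧-*-+ m (+ suc n)) ⟩
    - (⟦ + m ⟧ * ⟦ + suc n ⟧)         ≈⟨ -‿distribʳ-* _ _ ⟩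
    ⟦ + m ⟧ * ⟦ -[1+ n ] ⟧            ∎

  ⟦⟧-* : ∀ i j → ⟦ i ℤ.* j ⟧ ≈ ⟦ i ⟧ * ⟦ j ⟧
  ⟦⟧-* (+ m)    j = ⟦⟧-*-+ m j
  ⟦⟧-* -[1+ m ] j = begin
    ⟦ -[1+ m ] ℤ.* j ⟧             ≈⟨ reflexive (≡.cong ⟦_⟧ (≡.sym (ℤₚ.neg-distribˡ-* (+ suc m) j))) ⟩
    ⟦ ℤ.- (+ suc m ℤ.* j) ⟧        ≈⟨ ⟦⟧-neg (+ suc m ℤ.* j) ⟩
    - ⟦ + suc m ℤ.* j ⟧            ≈⟨ -‿cong (⟦⟧-*-+ (suc m) j) ⟩
    - (⟦ + suc m ⟧ * ⟦ j ⟧)        ≈⟨ -‿distribˡ-* _ _ ⟩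
    ⟦ -[1+ m ] ⟧ * ⟦ j ⟧           ∎

  private
    almostCommutativeRing : AlmostCommutativeRing 0ℓ 0ℓ
    almostCommutativeRing = fromCommutativeRing R

    homomorphism : CommutativeRing.rawRing ℤₚ.+-*-commutativeRing
                   -Raw-AlmostCommutative⟶ almostCommutativeRing
    homomorphism = record
      { ⟦_⟧ = ⟦_⟧ ; +-homo = ⟦⟧-+ ; *-homo = ⟦⟧-* ; -‿homo = ⟦⟧-neg
      ; 0-homo = refl ; 1-homo = refl }

    ⟦⟧-≟ : ∀ i j → Maybe (⟦ i ⟧ ≈ ⟦ j ⟧)
    ⟦⟧-≟ i j with i ℤ.≟ j
    ... | yes ≡.refl = just refl
    ... | no _       = nothing

  open import Algebra.Solver.Ring (CommutativeRing.rawRing ℤₚ.+-*-commutativeRing)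
    almostCommutativeRing homomorphism ⟦⟧-≟ public hiding (⟦_⟧)

-- Stated over an arbitrary ring: in Series₅ itself, comparing the solver's normal forms
-- with the statements unfolds the numerals and is prohibitively slow.
module RingIdentities (R : CommutativeRing 0ℓ 0ℓ) where

  open CommutativeRing R
  open IntegerCoefficients R using (solve; _:=_; _:+_; _:*_; _:-_; con)

  descent-split : ∀ m₁ m₂ m₃ n P Q →
    n * ((m₂ + m₃ * P + m₁ * (P * P)) * Q) ≈ m₁ * (n * (P * (P * Q))) + m₂ * (n * Q) + m₃ * (n * (P * Q))
  descent-split = solve 6 (λ m₁ m₂ m₃ n P Q →
    n :* ((m₂ :+ m₃ :* P :+ m₁ :* (P :* P)) :* Q)
      := m₁ :* (n :* (P :* (P :* Q))) :+ m₂ :* (n :* Q) :+ m₃ :* (n :* (P :* Q))) refl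

  square-completion : ∀ m₁ m₂ m₃ P →
    (1# - m₃ - (1# + 1#) * (m₁ * P)) * (1# - m₃ - (1# + 1#) * (m₁ * P))
      ≈ (1# - m₃) * (1# - m₃) - (((1# + 1#) + 1#) + 1#) * m₁ * m₂
        + (((1# + 1#) + 1#) + 1#) * m₁ * ((m₂ + m₃ * P + m₁ * (P * P)) - P)
  square-completion = solve 4 (λ m₁ m₂ m₃ P →
    (con (+ 1) :- m₃ :- con (+ 2) :* (m₁ :* P)) :* (con (+ 1) :- m₃ :- con (+ 2) :* (m₁ :* P))
      := (con (+ 1) :- m₃) :* (con (+ 1) :- m₃) :- con (+ 4) :* m₁ :* m₂
         :+ con (+ 4) :* m₁ :* ((m₂ :+ m₃ :* P :+ m₁ :* (P :* P)) :- P)) refl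

  difference-of-squares : ∀ S T → (S - T) * (S + T) ≈ S * S - T * T
  difference-of-squares = solve 2 (λ S T → (S :- T) :* (S :+ T) := S :* S :- T :* T) refl

  denominator-expansion : ∀ F m₁ m₃ n w P →
    F * ((1# + 1#) * (1# - m₃ * w) - n * (1# - m₃ - (1# - m₃ - (1# + 1#) * (m₁ * P))))
      ≈ (1# + 1#) * (F - (m₁ * (n * (P * F)) + m₃ * (w * F)))
  denominator-expansion = solve 6 (λ F m₁ m₃ n w P →
    F :* (con (+ 2) :* (con (+ 1) :- m₃ :* w) :- n :* (con (+ 1) :- m₃ :- (con (+ 1) :- m₃ :- con (+ 2) :* (m₁ :* P))))
      := con (+ 2) :* (F :- (m₁ :* (n :* (P :* F)) :+ m₃ :* (w :* F)))) refl

  cancel-sum : ∀ A B → (1# + 1#) * ((1# + A + B) - (A + B)) ≈ 1# + 1#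
  cancel-sum = solve 2 (λ A B → con (+ 2) :* ((con (+ 1) :+ A :+ B) :- (A :+ B)) := con (+ 2)) refl

-- Seriesₖ is the ring of power series over ℤ in the last k of the variables μ₁ μ₂ μ₃ ν ω,
-- so that the carrier of Series₅ is FPS, with equality ≈ₛ.
Series₀ Series₁ Series₂ Series₃ Series₄ Series₅ : CommutativeRing 0ℓ 0ℓ
Series₀ = ℤₚ.+-*-commutativeRing
Series₁ = PowerSeries.commutativeRing Series₀
Series₂ = PowerSeries.commutativeRing Series₁
Series₃ = PowerSeries.commutativeRing Series₂
Series₄ = PowerSeries.commutativeRing Series₃
Series₅ = PowerSeries.commutativeRing Series₄

module PS₀ = PowerSeries Series₀
module PS₁ = PowerSeries Series₁
module PS₂ = PowerSeries Series₂
module PS₃ = PowerSeries Series₃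
module PS₄ = PowerSeries Series₄

sumTo-cong : ∀ n {f g : ℕ → ℤ} → (∀ i → f i ≡ g i) → sumTo n f ≡ sumTo n g
sumTo-cong zero    f≡g = f≡g 0
sumTo-cong (suc n) f≡g = ≡.cong₂ ℤ._+_ (sumTo-cong n f≡g) (f≡g (suc n))

Σ₀≡sumTo : ∀ n f → PS₀.Σ n f ≡ sumTo n f
Σ₀≡sumTo zero    f = ≡.refl
Σ₀≡sumTo (suc n) f = ≡.cong (ℤ._+ f (suc n)) (Σ₀≡sumTo n f)

Σ-apply : ∀ R n (H : ℕ → PowerSeries.Series R) x →
  PowerSeries.Σ (PowerSeries.commutativeRing R) n H x ≡ PowerSeries.Σ R n (λ i → H i x)
Σ-apply R zero    H x = ≡.refl
Σ-apply R (suc n) H x = ≡.cong (λ s → CommutativeRing._+_ R s (H (suc n) x)) (Σ-apply R n H x)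

Σ₁≡sumTo : ∀ n H e → PS₁.Σ n H e ≡ sumTo n (λ i → H i e)
Σ₁≡sumTo n H e = ≡.trans (Σ-apply Series₀ n H e) (Σ₀≡sumTo n _)

Σ₂≡sumTo : ∀ n H d e → PS₂.Σ n H d e ≡ sumTo n (λ i → H i d e)
Σ₂≡sumTo n H d e = ≡.trans (≡.cong (λ s → s e) (Σ-apply Series₁ n H d)) (Σ₁≡sumTo n _ e)

Σ₃≡sumTo : ∀ n H c d e → PS₃.Σ n H c d e ≡ sumTo n (λ i → H i c d e)
Σ₃≡sumTo n H c d e = ≡.trans (≡.cong (λ s → s d e) (Σ-apply Series₂ n H c)) (Σ₂≡sumTo n _ d e)

Σ₄≡sumTo : ∀ n H b c d e → PS₄.Σ n H b c d e ≡ sumTo n (λ i → H i b c d e)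
Σ₄≡sumTo n H b c d e = ≡.trans (≡.cong (λ s → s c d e) (Σ-apply Series₃ n H b)) (Σ₃≡sumTo n _ c d e)

*ₛ≈* : ∀ f g → f *ₛ g ≈ₛ CommutativeRing._*_ Series₅ f g
*ₛ≈* f g a b c d e = ≡.sym (≡.trans (Σ₄≡sumTo a _ b c d e) (sumTo-cong a λ i → *₄ (f i) (g (a ∸ i)) b c d e))
  where
  *₁ : ∀ f g e → PS₀._*ₚ_ f g e ≡ sumTo e (λ m → f m ℤ.* g (e ∸ m))
  *₁ f g e = Σ₀≡sumTo e _

  *₂ : ∀ f g d e → PS₁._*ₚ_ f g d e ≡ sumTo d (λ l → sumTo e (λ m → f l m ℤ.* g (d ∸ l) (e ∸ m)))
  *₂ f g d e = ≡.trans (Σ₁≡sumTo d _ e) (sumTo-cong d λ l → *₁ (f l) (g (d ∸ l)) e)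

  *₃ : ∀ f g c d e → PS₂._*ₚ_ f g c d e ≡
    sumTo c (λ k → sumTo d (λ l → sumTo e (λ m → f k l m ℤ.* g (c ∸ k) (d ∸ l) (e ∸ m))))
  *₃ f g c d e = ≡.trans (Σ₂≡sumTo c _ d e) (sumTo-cong c λ k → *₂ (f k) (g (c ∸ k)) d e)

  *₄ : ∀ f g b c d e → PS₃._*ₚ_ f g b c d e ≡
    sumTo b (λ j → sumTo c (λ k → sumTo d (λ l → sumTo e (λ m →
      f j k l m ℤ.* g (b ∸ j) (c ∸ k) (d ∸ l) (e ∸ m)))))
  *₄ f g b c d e = ≡.trans (Σ₃≡sumTo b _ c d e) (sumTo-cong b λ j → *₃ (f j) (g (b ∸ j)) c d e)

-- ↑x f raises the exponent of the variable x by one in every term of f.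
↑μ₁ ↑μ₂ ↑μ₃ ↑ν ↑ω : FPS → FPS
↑μ₁ f         = PS₄.shift f
↑μ₂ f a       = PS₃.shift (f a)
↑μ₃ f a b     = PS₂.shift (f a b)
↑ν  f a b c   = PS₁.shift (f a b c)
↑ω  f a b c d = PS₀.shift (f a b c d)

-- Walks to the axis

count : {A : Set} → (A → Bool) → List A → ℕ
count p []       = 0
count p (x ∷ xs) = if p x then suc (count p xs) else count p xs

count-++ : ∀ {A : Set} (p : A → Bool) xs ys → count p (xs ++ ys) ≡ count p xs ℕ.+ count p ys
count-++ p []       ys = ≡.refl
count-++ p (x ∷ xs) ys with p x
... | true  = ≡.cong suc (count-++ p xs ys)
... | false = count-++ p xs ys

count-map : ∀ {A B : Set} (p : B → Bool) (f : A → B) xs → count p (map f xs) ≡ count (λ x → p (f x)) xs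
count-map p f []       = ≡.refl
count-map p f (x ∷ xs) with p (f x)
... | true  = ≡.cong suc (count-map p f xs)
... | false = count-map p f xs

count-cong : ∀ {A : Set} {p q : A → Bool} xs → (∀ x → p x ≡ q x) → count p xs ≡ count q xs
count-cong                  []       p≡q = ≡.refl
count-cong {p = p} {q = q} (x ∷ xs) p≡q rewrite p≡q x =
  ≡.cong (λ n → if q x then suc n else n) (count-cong xs p≡q)

count-false : ∀ {A : Set} (p : A → Bool) xs → (∀ x → p x ≡ false) → count p xs ≡ 0
count-false p []       p≡false = ≡.refl
count-false p (x ∷ xs) p≡false rewrite p≡false x = count-false p xs p≡false

length-filterᵇ-filterᵇ : ∀ {A : Set} (p q : A → Bool) xs →
  length (filterᵇ q (filterᵇ p xs)) ≡ count (λ x → p x ∧ q x) xs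
length-filterᵇ-filterᵇ p q [] = ≡.refl
length-filterᵇ-filterᵇ p q (x ∷ xs) with p x
... | false = length-filterᵇ-filterᵇ p q xs
... | true with q x
...   | true  = ≡.cong suc (length-filterᵇ-filterᵇ p q xs)
...   | false = length-filterᵇ-filterᵇ p q xs

count-words-suc : ∀ p n → count p (words (suc n)) ≡
  count (λ w → p (U ∷ w)) (words n) ℕ.+ (count (λ w → p (D ∷ w)) (words n) ℕ.+
  (count (λ w → p (L ∷ w)) (words n) ℕ.+ 0))
count-words-suc p n =
  ≡.trans (count-++ p (map (U ∷_) W) _) (≡.cong₂ ℕ._+_ (count-map p (U ∷_) W)
  (≡.trans (count-++ p (map (D ∷_) W) _) (≡.cong₂ ℕ._+_ (count-map p (D ∷_) W)
  (≡.trans (count-++ p (map (L ∷_) W) _) (≡.cong₂ ℕ._+_ (count-map p (L ∷_) W) ≡.refl)))))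
  where W = words n

∧-falseʳ : ∀ x {y} → y ≡ false → x ∧ y ≡ false
∧-falseʳ x ≡.refl = Boolₚ.∧-zeroʳ x

isJustZero : Maybe ℕ → Bool
isJustZero (just zero) = true
isJustZero _           = false

isMotzkin≡isJustZero : ∀ w → isMotzkin w ≡ isJustZero (walk 0 w)
isMotzkin≡isJustZero w with walk 0 w
... | just zero    = ≡.refl
... | just (suc _) = ≡.refl
... | nothing      = ≡.refl

returnsWith : ℕ → ℕ → ℕ → ℕ → ℕ → ℕ → List Step → Bool
returnsWith h a b c d e w = isJustZero (walk h w) ∧
  ((#U w ≡ᵇ a) ∧ (#D w ≡ᵇ b) ∧ (#L w ≡ᵇ c) ∧ (#Dx h w ≡ᵇ d) ∧ (#Lx h w ≡ᵇ e))

-- only words of length a + b + c can have a up, b down and c level steps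
walksFrom : ℕ → FPS
walksFrom h a b c d e = + count (returnsWith h a b c d e) (words (a ℕ.+ b ℕ.+ c))

motzkin-count : ∀ a b c d e m →
  length (filterᵇ (matches a b c d e) (motzkin m)) ≡ count (returnsWith 0 a b c d e) (words m)
motzkin-count a b c d e m = ≡.trans (length-filterᵇ-filterᵇ isMotzkin (matches a b c d e) (words m))
  (count-cong (words m) (λ w → ≡.cong (_∧ matches a b c d e w) (isMotzkin≡isJustZero w)))

F≈walksFrom0 : F ≈ₛ walksFrom 0
F≈walksFrom0 zero    zero    zero    zero    zero    = ≡.refl
F≈walksFrom0 zero    zero    zero    zero    (suc e) = ≡.refl
F≈walksFrom0 zero    zero    zero    (suc d) zero    = ≡.refl
F≈walksFrom0 zero    zero    zero    (suc d) (suc e) = ≡.refl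
F≈walksFrom0 (suc a) b       c       d       e       = ≡.cong +_ (motzkin-count (suc a) b c d e (suc (a ℕ.+ b ℕ.+ c)))
F≈walksFrom0 zero    (suc b) c       d       e       = ≡.cong +_ (motzkin-count zero (suc b) c d e (suc (b ℕ.+ c)))
F≈walksFrom0 zero    zero    (suc c) d       e       = ≡.cong +_ (motzkin-count zero zero (suc c) d e (suc c))

-- a down step from height h + 1 ends on the axis, and is marked by ν, exactly when h = 0;
-- likewise a level step from height h is marked by ω exactly when h = 0
↑ν-if-zero ↑ω-if-zero : ℕ → FPS → FPS
↑ν-if-zero zero    = ↑ν
↑ν-if-zero (suc _) = λ f → f
↑ω-if-zero zero    = ↑ω
↑ω-if-zero (suc _) = λ f → f

emptyWalk : ℕ → FPS
emptyWalk zero    = const (+ 1)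
emptyWalk (suc _) = λ _ _ _ _ _ → + 0

firstStepDown : ℕ → FPS
firstStepDown zero    = λ _ _ _ _ _ → + 0
firstStepDown (suc h) = ↑μ₂ (↑ν-if-zero h (walksFrom h))

walksFrom-coefficient : ∀ h a b c d e {n} → a ℕ.+ b ℕ.+ c ≡ n →
  + count (returnsWith h a b c d e) (words n) ≡ walksFrom h a b c d e
walksFrom-coefficient h a b c d e a+b+c≡n =
  ≡.cong (λ m → + count (returnsWith h a b c d e) (words m)) (≡.sym a+b+c≡n)

module _ (a b c : ℕ) {n : ℕ} where

  drop-D : a ℕ.+ suc b ℕ.+ c ≡ suc n → a ℕ.+ b ℕ.+ c ≡ n
  drop-D eq = ℕₚ.suc-injective (≡.trans (≡.cong (ℕ._+ c) (≡.sym (ℕₚ.+-suc a b))) eq)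

  drop-L : a ℕ.+ b ℕ.+ suc c ≡ suc n → a ℕ.+ b ℕ.+ c ≡ n
  drop-L eq = ℕₚ.suc-injective (≡.trans (≡.sym (ℕₚ.+-suc (a ℕ.+ b) c)) eq)

first-U : ∀ h a b c d e n → a ℕ.+ b ℕ.+ c ≡ suc n →
  + count (λ w → returnsWith h a b c d e (U ∷ w)) (words n) ≡ ↑μ₁ (walksFrom (suc h)) a b c d e
first-U h zero    b c d e n _  =
  ≡.cong +_ (count-false _ (words n) λ w → ∧-falseʳ (isJustZero (walk (suc h) w)) ≡.refl)
first-U h (suc a) b c d e n eq = walksFrom-coefficient (suc h) a b c d e (ℕₚ.suc-injective eq)

first-D : ∀ h a b c d e n → a ℕ.+ b ℕ.+ c ≡ suc n →
  + count (λ w → returnsWith h a b c d e (D ∷ w)) (words n) ≡ firstStepDown h a b c d e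
first-D zero          a b       c d       e n _  = ≡.cong +_ (count-false _ (words n) λ w → ≡.refl)
first-D (suc h)       a zero    c d       e n _  =
  ≡.cong +_ (count-false _ (words n) λ w → ∧-falseʳ (isJustZero (walk h w)) (∧-falseʳ (#U w ≡ᵇ a) ≡.refl))
first-D (suc zero)    a (suc b) c zero    e n _  =
  ≡.cong +_ (count-false _ (words n) λ w → ∧-falseʳ (isJustZero (walk 0 w))
    (∧-falseʳ (#U w ≡ᵇ a) (∧-falseʳ (#D w ≡ᵇ b) (∧-falseʳ (#L w ≡ᵇ c) ≡.refl))))
first-D (suc zero)    a (suc b) c (suc d) e n eq = walksFrom-coefficient 0 a b c d e (drop-D a b c eq)
first-D (suc (suc h)) a (suc b) c d       e n eq = walksFrom-coefficient (suc h) a b c d e (drop-D a b c eq)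

first-L : ∀ h a b c d e n → a ℕ.+ b ℕ.+ c ≡ suc n →
  + count (λ w → returnsWith h a b c d e (L ∷ w)) (words n) ≡ ↑μ₃ (↑ω-if-zero h (walksFrom h)) a b c d e
first-L h       a b zero    d e       n _  =
  ≡.cong +_ (count-false _ (words n) λ w → ∧-falseʳ (isJustZero (walk h w))
    (∧-falseʳ (#U w ≡ᵇ a) (∧-falseʳ (#D w ≡ᵇ b) ≡.refl)))
first-L zero    a b (suc c) d zero    n _  =
  ≡.cong +_ (count-false _ (words n) λ w → ∧-falseʳ (isJustZero (walk 0 w))
    (∧-falseʳ (#U w ≡ᵇ a) (∧-falseʳ (#D w ≡ᵇ b) (∧-falseʳ (#L w ≡ᵇ c) (∧-falseʳ (#Dx 0 w ≡ᵇ d) ≡.refl)))))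
first-L zero    a b (suc c) d (suc e) n eq = walksFrom-coefficient 0 a b c d e (drop-L a b c eq)
first-L (suc h) a b (suc c) d e       n eq = walksFrom-coefficient (suc h) a b c d e (drop-L a b c eq)

emptyWalk-vanishes : ∀ h a b c d e n → a ℕ.+ b ℕ.+ c ≡ suc n → + 0 ≡ emptyWalk h a b c d e
emptyWalk-vanishes (suc h) a       b       c       d e n _  = ≡.refl
emptyWalk-vanishes zero    (suc a) b       c       d e n _  = ≡.refl
emptyWalk-vanishes zero    zero    (suc b) c       d e n _  = ≡.refl
emptyWalk-vanishes zero    zero    zero    (suc c) d e n _  = ≡.refl
emptyWalk-vanishes zero    zero    zero    zero    d e n ()

walksFrom-recurrence-at : ∀ h a b c d e n → a ℕ.+ b ℕ.+ c ≡ suc n →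
  walksFrom h a b c d e ≡
  (emptyWalk h +ₛ ↑μ₁ (walksFrom (suc h)) +ₛ firstStepDown h +ₛ ↑μ₃ (↑ω-if-zero h (walksFrom h))) a b c d e
walksFrom-recurrence-at h a b c d e n eq = begin
  walksFrom h a b c d e                                         ≡⟨ walksFrom-coefficient h a b c d e eq ⟨
  + count p (words (suc n))                                     ≡⟨ ≡.cong +_ (count-words-suc p n) ⟩
  + (#first U ℕ.+ (#first D ℕ.+ (#first L ℕ.+ 0)))              ≡⟨ ≡.cong +_ (ℕ-rearrange (#first U) (#first D) (#first L)) ⟩
  + 0 ℤ.+ + #first U ℤ.+ + #first D ℤ.+ + #first L              ≡⟨ ≡.cong₂ ℤ._+_ (≡.cong₂ ℤ._+_ (≡.cong₂ ℤ._+_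
                                                                     (emptyWalk-vanishes h a b c d e n eq) (first-U h a b c d e n eq))
                                                                     (first-D h a b c d e n eq)) (first-L h a b c d e n eq) ⟩
  (emptyWalk h +ₛ ↑μ₁ (walksFrom (suc h)) +ₛ firstStepDown h +ₛ ↑μ₃ (↑ω-if-zero h (walksFrom h))) a b c d e ∎
  where
  open ≡.≡-Reasoning
  p = returnsWith h a b c d e
  #first : Step → ℕ
  #first s = count (λ w → p (s ∷ w)) (words n)
  ℕ-rearrange : ∀ u v w → u ℕ.+ (v ℕ.+ (w ℕ.+ 0)) ≡ u ℕ.+ v ℕ.+ w
  ℕ-rearrange u v w = ≡.trans (≡.cong (λ x → u ℕ.+ (v ℕ.+ x)) (ℕₚ.+-identityʳ w)) (≡.sym (ℕₚ.+-assoc u v w))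

walksFrom-recurrence : ∀ h →
  walksFrom h ≈ₛ emptyWalk h +ₛ ↑μ₁ (walksFrom (suc h)) +ₛ firstStepDown h +ₛ ↑μ₃ (↑ω-if-zero h (walksFrom h))
walksFrom-recurrence zero    zero    zero    zero    zero    zero    = ≡.refl
walksFrom-recurrence zero    zero    zero    zero    zero    (suc e) = ≡.refl
walksFrom-recurrence zero    zero    zero    zero    (suc d) zero    = ≡.refl
walksFrom-recurrence zero    zero    zero    zero    (suc d) (suc e) = ≡.refl
walksFrom-recurrence (suc h) zero    zero    zero    d       e       = ≡.refl
walksFrom-recurrence h       (suc a) b       c       d       e       = walksFrom-recurrence-at h (suc a) b c d e _ ≡.refl
walksFrom-recurrence h       zero    (suc b) c       d       e       = walksFrom-recurrence-at h zero (suc b) c d e _ ≡.refl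
walksFrom-recurrence h       zero    zero    (suc c) d       e       = walksFrom-recurrence-at h zero zero (suc c) d e _ ≡.refl

-- The generating function

filtration₁ : CompleteFiltration Series₁
filtration₁ = PowerSeriesFiltration.filtration discreteFiltration

filtration₂ : CompleteFiltration Series₂
filtration₂ = PowerSeriesFiltration.filtration filtration₁

filtration₃ : CompleteFiltration Series₃
filtration₃ = PowerSeriesFiltration.filtration filtration₂

filtration₄ : CompleteFiltration Series₄
filtration₄ = PowerSeriesFiltration.filtration filtration₃

filtration₅ : CompleteFiltration Series₅
filtration₅ = PowerSeriesFiltration.filtration filtration₄

regular₅ : ∀ f → IsRegular Series₀ (f 0 0 0 0 0) → IsRegular Series₅ f
regular₅ f r = PS₄.regular {f} (PS₃.regular {f 0} (PS₂.regular {f 0 0} (PS₁.regular {f 0 0 0} (PS₀.regular {f 0 0 0 0} r))))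

two-regular : IsRegular Series₀ (+ 2)
two-regular y y*2≡0 = ℤₚ.*-cancelʳ-≡ y (+ 0) (+ 2) y*2≡0

open CommutativeRing Series₅ hiding (zero)
open RingIdentities Series₅
open CompleteFiltration filtration₅
  using (_≈[_]_; ≈[0]; ≈⇒≈[]; ≈[]-sym; ≈[]-trans; +-cong[]; *-cong[]; separated; Raising; Raising-resp;
         fixpoint; fixpoint-unfold)
open SetoidReasoning setoid

const-1 : const (+ 1) ≈ 1#
const-1 zero    zero    zero    zero    zero    = ≡.refl
const-1 zero    zero    zero    zero    (suc e) = ≡.refl
const-1 zero    zero    zero    (suc d) e       = ≡.refl
const-1 zero    zero    (suc c) d       e       = ≡.refl
const-1 zero    (suc b) c       d       e       = ≡.refl
const-1 (suc a) b       c       d       e       = ≡.refl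

const-+ : ∀ x y → const (x ℤ.+ y) ≈ const x + const y
const-+ x y zero    zero    zero    zero    zero    = ≡.refl
const-+ x y zero    zero    zero    zero    (suc e) = ≡.refl
const-+ x y zero    zero    zero    (suc d) e       = ≡.refl
const-+ x y zero    zero    (suc c) d       e       = ≡.refl
const-+ x y zero    (suc b) c       d       e       = ≡.refl
const-+ x y (suc a) b       c       d       e       = ≡.refl

const-2 : const (+ 2) ≈ 1# + 1#
const-2 = trans (const-+ (+ 1) (+ 1)) (+-cong const-1 const-1)

const-4 : const (+ 4) ≈ ((1# + 1#) + 1#) + 1#
const-4 = trans (const-+ (+ 3) (+ 1)) (+-cong (trans (const-+ (+ 2) (+ 1)) (+-cong const-2 const-1)) const-1)

μ₁≈X : μ₁ ≈ PS₄.X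
μ₁≈X zero          b       c       d       e       = ≡.refl
μ₁≈X (suc (suc a)) b       c       d       e       = ≡.refl
μ₁≈X 1             (suc b) c       d       e       = ≡.refl
μ₁≈X 1             zero    (suc c) d       e       = ≡.refl
μ₁≈X 1             zero    zero    (suc d) e       = ≡.refl
μ₁≈X 1             zero    zero    zero    (suc e) = ≡.refl
μ₁≈X 1             zero    zero    zero    zero    = ≡.refl

μ₂≈X : μ₂ ≈ PS₄.ι PS₃.X
μ₂≈X (suc a) b             c       d       e       = ≡.refl
μ₂≈X zero    zero          c       d       e       = ≡.refl
μ₂≈X zero    (suc (suc b)) c       d       e       = ≡.refl
μ₂≈X zero    1             (suc c) d       e       = ≡.refl
μ₂≈X zero    1             zero    (suc d) e       = ≡.refl
μ₂≈X zero    1             zero    zero    (suc e) = ≡.refl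
μ₂≈X zero    1             zero    zero    zero    = ≡.refl

μ₃≈X : μ₃ ≈ PS₄.ι (PS₃.ι PS₂.X)
μ₃≈X (suc a) b       c             d       e       = ≡.refl
μ₃≈X zero    (suc b) c             d       e       = ≡.refl
μ₃≈X zero    zero    zero          d       e       = ≡.refl
μ₃≈X zero    zero    (suc (suc c)) d       e       = ≡.refl
μ₃≈X zero    zero    1             (suc d) e       = ≡.refl
μ₃≈X zero    zero    1             zero    (suc e) = ≡.refl
μ₃≈X zero    zero    1             zero    zero    = ≡.refl

ν≈X : ν ≈ PS₄.ι (PS₃.ι (PS₂.ι PS₁.X))
ν≈X (suc a) b       c       d             e       = ≡.refl
ν≈X zero    (suc b) c       d             e       = ≡.refl
ν≈X zero    zero    (suc c) d             e       = ≡.refl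
ν≈X zero    zero    zero    zero          e       = ≡.refl
ν≈X zero    zero    zero    (suc (suc d)) e       = ≡.refl
ν≈X zero    zero    zero    1             (suc e) = ≡.refl
ν≈X zero    zero    zero    1             zero    = ≡.refl

ω≈X : ω ≈ PS₄.ι (PS₃.ι (PS₂.ι (PS₁.ι PS₀.X)))
ω≈X (suc a) b       c       d       e             = ≡.refl
ω≈X zero    (suc b) c       d       e             = ≡.refl
ω≈X zero    zero    (suc c) d       e             = ≡.refl
ω≈X zero    zero    zero    (suc d) e             = ≡.refl
ω≈X zero    zero    zero    zero    zero          = ≡.refl
ω≈X zero    zero    zero    zero    (suc (suc e)) = ≡.refl
ω≈X zero    zero    zero    zero    1             = ≡.refl

μ₁-* : ∀ f → μ₁ * f ≈ ↑μ₁ f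
μ₁-* f = trans (*-congʳ {f} μ₁≈X) (PS₄.X-*ˡ f)

μ₂-* : ∀ f → μ₂ * f ≈ ↑μ₂ f
μ₂-* f = trans (*-congʳ {f} μ₂≈X) (trans (PS₄.ι-*ˡ _ f) λ a → PS₃.X-*ˡ (f a))

μ₃-* : ∀ f → μ₃ * f ≈ ↑μ₃ f
μ₃-* f = trans (*-congʳ {f} μ₃≈X) (trans (PS₄.ι-*ˡ _ f) λ a →
  CommutativeRing.trans Series₄ (PS₃.ι-*ˡ _ (f a)) λ b → PS₂.X-*ˡ (f a b))

ν-* : ∀ f → ν * f ≈ ↑ν f
ν-* f = trans (*-congʳ {f} ν≈X) (trans (PS₄.ι-*ˡ _ f) λ a →
  CommutativeRing.trans Series₄ (PS₃.ι-*ˡ _ (f a)) λ b →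
  CommutativeRing.trans Series₃ (PS₂.ι-*ˡ _ (f a b)) λ c → PS₁.X-*ˡ (f a b c))

ω-* : ∀ f → ω * f ≈ ↑ω f
ω-* f = trans (*-congʳ {f} ω≈X) (trans (PS₄.ι-*ˡ _ f) λ a →
  CommutativeRing.trans Series₄ (PS₃.ι-*ˡ _ (f a)) λ b →
  CommutativeRing.trans Series₃ (PS₂.ι-*ˡ _ (f a b)) λ c →
  CommutativeRing.trans Series₂ (PS₁.ι-*ˡ _ (f a b c)) λ d → PS₀.X-*ˡ (f a b c d))

μ₁-raising : Raising (μ₁ *_)
μ₁-raising = Raising-resp (λ f → sym (μ₁-* f)) (PowerSeriesFiltration.shift-raising filtration₄)

μ₂-raising : Raising (μ₂ *_)
μ₂-raising = Raising-resp (λ f → sym (μ₂-* f))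
  (PowerSeriesFiltration.map-raising filtration₄ (PowerSeriesFiltration.shift-raising filtration₃))

μ₃-raising : Raising (μ₃ *_)
μ₃-raising = Raising-resp (λ f → sym (μ₃-* f))
  (PowerSeriesFiltration.map-raising filtration₄ (PowerSeriesFiltration.map-raising filtration₃
    (PowerSeriesFiltration.shift-raising filtration₂)))

ν-if-zero : ℕ → Carrier → Carrier
ν-if-zero zero    x = ν * x
ν-if-zero (suc _) x = x

↑ν-if-zero≈ν-if-zero : ∀ h f → ↑ν-if-zero h f ≈ ν-if-zero h f
↑ν-if-zero≈ν-if-zero zero    f = sym (ν-* f)
↑ν-if-zero≈ν-if-zero (suc h) f = refl

walksFrom0-equation : walksFrom 0 ≈ 1# + μ₁ * walksFrom 1 + μ₃ * (ω * walksFrom 0)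
walksFrom0-equation = begin
  walksFrom 0                                                    ≈⟨ walksFrom-recurrence 0 ⟩
  const (+ 1) + ↑μ₁ (walksFrom 1) + 0# + ↑μ₃ (↑ω (walksFrom 0))  ≈⟨ +-cong
    (trans (+-identityʳ (const (+ 1) + ↑μ₁ (walksFrom 1))) (+-cong const-1 (sym (μ₁-* (walksFrom 1)))))
    (trans (sym (μ₃-* (↑ω (walksFrom 0)))) (*-congˡ {μ₃} (sym (ω-* (walksFrom 0))))) ⟩
  1# + μ₁ * walksFrom 1 + μ₃ * (ω * walksFrom 0)                 ∎

AxisRecurrence : (ℕ → Carrier) → Set
AxisRecurrence Y = ∀ h → Y (suc h) ≈ μ₁ * Y (suc (suc h)) + μ₂ * ν-if-zero h (Y h) + μ₃ * Y (suc h)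

walksFrom-axisRecurrence : AxisRecurrence walksFrom
walksFrom-axisRecurrence h = begin
  walksFrom (suc h)
    ≈⟨ walksFrom-recurrence (suc h) ⟩
  0# + ↑μ₁ (walksFrom (suc (suc h))) + ↑μ₂ (↑ν-if-zero h (walksFrom h)) + ↑μ₃ (walksFrom (suc h))
    ≈⟨ +-cong (+-cong (trans (+-identityˡ (↑μ₁ (walksFrom (suc (suc h))))) (sym (μ₁-* (walksFrom (suc (suc h))))))
                      (trans (sym (μ₂-* (↑ν-if-zero h (walksFrom h)))) (*-congˡ {μ₂} (↑ν-if-zero≈ν-if-zero h (walksFrom h)))))
              (sym (μ₃-* (walksFrom (suc h)))) ⟩
  μ₁ * walksFrom (suc (suc h)) + μ₂ * ν-if-zero h (walksFrom h) + μ₃ * walksFrom (suc h)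
    ∎

axisRecurrence-unique : ∀ {Y Z} → Y 0 ≈ Z 0 → AxisRecurrence Y → AxisRecurrence Z → ∀ h → Y h ≈ Z h
axisRecurrence-unique {Y} {Z} Y₀≈Z₀ recY recZ h = separated λ N → agree N h
  where
  ν-if-zero-cong[] : ∀ {N x y} h → x ≈[ N ] y → ν-if-zero h x ≈[ N ] ν-if-zero h y
  ν-if-zero-cong[] zero    x≈y = *-cong[] (≈⇒≈[] (refl {ν})) x≈y
  ν-if-zero-cong[] (suc h) x≈y = x≈y

  agree : ∀ N h → Y h ≈[ N ] Z h
  agree N       zero    = ≈⇒≈[] Y₀≈Z₀
  agree zero    (suc h) = ≈[0]
  agree (suc N) (suc h) = ≈[]-trans (≈⇒≈[] (recY h)) (≈[]-trans
    (+-cong[] (+-cong[] (μ₁-raising (agree N (suc (suc h)))) (μ₂-raising (ν-if-zero-cong[] h (agree N h))))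
              (μ₃-raising (agree N (suc h))))
    (≈[]-sym (≈⇒≈[] (recZ h))))

excursionStep : Carrier → Carrier
excursionStep Q = μ₂ + μ₃ * Q + μ₁ * (Q * Q)

excursionStep-raising : Raising excursionStep
excursionStep-raising Q≈Q′ = +-cong[] (+-cong[] (≈⇒≈[] (refl {μ₂})) (μ₃-raising Q≈Q′)) (μ₁-raising (*-cong[] Q≈Q′ Q≈Q′))

-- P counts the walks from height 1 that reach the axis only at their last step, with ν unmarked.
P : Carrier
P = fixpoint excursionStep excursionStep-raising

P-equation : P ≈ μ₂ + μ₃ * P + μ₁ * (P * P)
P-equation = fixpoint-unfold excursionStep excursionStep-raising

P^ : ℕ → Carrier → Carrier
P^ zero    x = x
P^ (suc n) x = P * P^ n x

-- A walk from height h + 1 splits into h + 1 first-passage descents, the last marked by ν,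
-- followed by a walk from height 0.
factorised : ℕ → Carrier
factorised zero    = walksFrom 0
factorised (suc h) = ν * P^ (suc h) (walksFrom 0)

factorised-axisRecurrence : AxisRecurrence factorised
factorised-axisRecurrence h = begin
  ν * (P * Q)                                              ≈⟨ *-congˡ {ν} (*-congʳ {Q} P-equation) ⟩
  ν * ((μ₂ + μ₃ * P + μ₁ * (P * P)) * Q)                   ≈⟨ descent-split μ₁ μ₂ μ₃ ν P Q ⟩
  μ₁ * (ν * (P * (P * Q))) + μ₂ * (ν * Q) + μ₃ * (ν * (P * Q))  ≈⟨ +-congʳ {μ₃ * (ν * (P * Q))} (+-congˡ {μ₁ * (ν * (P * (P * Q)))} (*-congˡ {μ₂} (last-descent h))) ⟩
  μ₁ * factorised (suc (suc h)) + μ₂ * ν-if-zero h (factorised h) + μ₃ * factorised (suc h) ∎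
  where
  Q = P^ h (walksFrom 0)
  last-descent : ∀ h → ν * P^ h (walksFrom 0) ≈ ν-if-zero h (factorised h)
  last-descent zero    = refl
  last-descent (suc h) = refl

walksFrom1-factorisation : walksFrom 1 ≈ ν * (P * walksFrom 0)
walksFrom1-factorisation = axisRecurrence-unique refl walksFrom-axisRecurrence factorised-axisRecurrence 1

F-equation : F ≈ 1# + μ₁ * (ν * (P * F)) + μ₃ * (ω * F)
F-equation = begin
  F                                                       ≈⟨ F≈walksFrom0 ⟩
  walksFrom 0                                             ≈⟨ walksFrom0-equation ⟩
  1# + μ₁ * walksFrom 1 + μ₃ * (ω * walksFrom 0)          ≈⟨ +-cong (+-congˡ {1#} (*-congˡ {μ₁}
    (trans walksFrom1-factorisation (*-congˡ {ν} (*-congˡ {P} (sym F≈walksFrom0))))))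
    (*-congˡ {μ₃} (*-congˡ {ω} (sym F≈walksFrom0))) ⟩
  1# + μ₁ * (ν * (P * F)) + μ₃ * (ω * F)                  ∎

S₀ : Carrier
S₀ = 1# - μ₃ - (1# + 1#) * (μ₁ * P)

S₀-constant : S₀ 0 0 0 0 0 ≡ + 1
S₀-constant = ≡.refl

radicand≈ : radicand ≈ (1# - μ₃) * (1# - μ₃) - (((1# + 1#) + 1#) + 1#) * μ₁ * μ₂
radicand≈ = +-cong
  (trans (*ₛ≈* (const (+ 1) -ₛ μ₃) (const (+ 1) -ₛ μ₃)) (*-cong 1-μ₃ 1-μ₃))
  (-‿cong (trans (*ₛ≈* (const (+ 4) *ₛ μ₁) μ₂) (*-congʳ {μ₂} (trans (*ₛ≈* (const (+ 4)) μ₁) (*-congʳ {μ₁} const-4)))))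
  where
  1-μ₃ : const (+ 1) -ₛ μ₃ ≈ 1# - μ₃
  1-μ₃ = +-congʳ { - μ₃} const-1

S₀-square : S₀ * S₀ ≈ radicand
S₀-square = begin
  S₀ * S₀                                          ≈⟨ square-completion μ₁ μ₂ μ₃ P ⟩
  R + four * ((μ₂ + μ₃ * P + μ₁ * (P * P)) - P)    ≈⟨ +-congˡ {R} (*-congˡ {four} (+-congʳ { - P} P-equation)) ⟨
  R + four * (P - P)                               ≈⟨ +-congˡ {R} (*-congˡ {four} (-‿inverseʳ P)) ⟩
  R + four * 0#                                    ≈⟨ +-congˡ {R} (zeroʳ four) ⟩
  R + 0#                                           ≈⟨ +-identityʳ R ⟩
  R                                                ≈⟨ radicand≈ ⟨
  radicand                                         ∎
  where
  four = (((1# + 1#) + 1#) + 1#) * μ₁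
  R = (1# - μ₃) * (1# - μ₃) - four * μ₂

-- S - S₀ annihilates S + S₀, whose constant term 2 is not a zero divisor.
sqrt-unique : ∀ S → IsSqrtRadicand S → S ≈ S₀
sqrt-unique S (S²≈radicand , S-constant) =
  x∙y⁻¹≈ε⇒x≈y S S₀ (regular₅ (S + S₀) (≡.subst (IsRegular Series₀) constant≡2 two-regular) (S - S₀) product≈0)
  where
  open import Algebra.Properties.Group +-group using (x∙y⁻¹≈ε⇒x≈y)

  constant≡2 : + 2 ≡ S 0 0 0 0 0 ℤ.+ S₀ 0 0 0 0 0
  constant≡2 = ≡.sym (≡.cong₂ ℤ._+_ S-constant S₀-constant)

  product≈0 : (S - S₀) * (S + S₀) ≈ 0#
  product≈0 = begin
    (S - S₀) * (S + S₀)    ≈⟨ difference-of-squares S S₀ ⟩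
    S * S - S₀ * S₀        ≈⟨ +-cong (trans (sym (*ₛ≈* S S)) S²≈radicand) (-‿cong S₀-square) ⟩
    radicand - radicand    ≈⟨ -‿inverseʳ radicand ⟩
    0#                     ∎

denom≈ : ∀ S → S ≈ S₀ → denom S ≈ (1# + 1#) * (1# - μ₃ * ω) - ν * (1# - μ₃ - S₀)
denom≈ S S≈S₀ = +-cong
  (trans (*ₛ≈* (const (+ 2)) (const (+ 1) -ₛ μ₃ *ₛ ω)) (*-cong const-2 (+-cong const-1 (-‿cong (*ₛ≈* μ₃ ω)))))
  (-‿cong (trans (*ₛ≈* ν (const (+ 1) -ₛ μ₃ -ₛ S)) (*-congˡ {ν} (+-cong (+-congʳ { - μ₃} const-1) (-‿cong S≈S₀)))))

lemma4p8 : (∃ λ S → IsSqrtRadicand S)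
    × (∀ S → IsSqrtRadicand S → F *ₛ denom S ≈ₛ const (+ 2))
lemma4p8 = (S₀ , trans (*ₛ≈* S₀ S₀) S₀-square , S₀-constant) , F-times-denom
  where
  F-times-denom : ∀ S → IsSqrtRadicand S → F *ₛ denom S ≈ const (+ 2)
  F-times-denom S S-sqrt = begin
    F *ₛ denom S                                                    ≈⟨ *ₛ≈* F (denom S) ⟩
    F * denom S                                                     ≈⟨ *-congˡ {F} (denom≈ S (sqrt-unique S S-sqrt)) ⟩
    F * ((1# + 1#) * (1# - μ₃ * ω) - ν * (1# - μ₃ - S₀))            ≈⟨ denominator-expansion F μ₁ μ₃ ν ω P ⟩
    (1# + 1#) * (F - (A + B))                                       ≈⟨ *-congˡ {1# + 1#} (+-congʳ { - (A + B)} F-equation) ⟩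
    (1# + 1#) * ((1# + A + B) - (A + B))                            ≈⟨ cancel-sum A B ⟩
    1# + 1#                                                         ≈⟨ const-2 ⟨
    const (+ 2)                                                     ∎
    where
    A = μ₁ * (ν * (P * F))
    B = μ₃ * (ω * F)
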